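{- For $n\ge0$, let $\rho_{pod}(n)$ denote the number of partitions of $n$ in which the largest part $\lambda$ appears exactly once and the remaining parts form a partition of $\lambda$ in which the odd parts are distinct (even parts unrestricted), and let $\rho_{ped}(n)$ denote the number of partitions of $n$ in which the largest part $\lambda$ appears exactly once and the remaining parts form a partition of $\lambda$ in which the even parts are distinct (odd parts unrestricted). Then, as formal power series (equivalently for $|q|<1$), $$\sum_{n=0}^{\infty}\rho_{pod}(n)q^n=\frac{(q^4;q^4)_\infty}{(q^2;q^2)_\infty(q^8;q^8)_\infty}-\frac{1}{1-q^2},\qquad \sum_{n=0}^{\infty}\rho_{ped}(n)q^n=\frac{(q^8;q^8)_\infty}{(q^2;q^2)_\infty}-\frac{1}{1-q^2}.$$
   Context: For $|q|<1$, $(a;q)_\infty=\prod_{k=0}^{\infty}(1-aq^k)$. Since the largest part $\lambda$ appears exactly once, all remaining parts are strictly smaller than $\lambda$, and $n=2\lambda$. The empty partition has no largest part, so both counts are $0$ at $n=0$. -}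

module Defs where

open import Data.Nat as ℕ using (ℕ; zero; suc; _≤_; _<_; _∸_; _≥_)
open import Data.Nat.Divisibility using (_∣_)
open import Data.Integer as ℤ using (ℤ; +_; -_)
open import Data.List using (List; []; _∷_; length; filter; map; upTo; zipWith; foldr)
open import Data.Nat.ListAction using (sum)
open import Data.List.Relation.Unary.All using (All)
open import Data.List.Relation.Unary.Linked using (Linked)
open import Data.List.Relation.Unary.Unique.Propositional using (Unique)
open import Data.List.Membership.Propositional using (_∈_)
open import Data.Product using (_×_; Σ)
open import Data.Empty using (⊥)
open import Relation.Nullary using (¬_)
open import Relation.Nullary.Decidable using (does)
open import Relation.Binary.PropositionalEquality using (_≡_)
open import Data.Bool using (if_then_else_)
open import Function.Bundles using (_⇔_)

IsPartition : ℕ → List ℕ → Set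
IsPartition n l = All (1 ≤_) l × Linked _≥_ l × sum l ≡ n

mult : ℕ → List ℕ → ℕ
mult k l = length (filter (ℕ._≟ k) l)

OddDistinct : List ℕ → Set
OddDistinct l = ∀ k → ¬ (2 ∣ k) → mult k l ≤ 1

EvenDistinct : List ℕ → Set
EvenDistinct l = ∀ k → 2 ∣ k → mult k l ≤ 1

-- For a partition listed in non-increasing order, the head is the largest
-- part λ.
LargestOnceRest : (List ℕ → Set) → List ℕ → Set
LargestOnceRest P []         = ⊥
LargestOnceRest P (λ' ∷ rest) = All (_< λ') rest × sum rest ≡ λ' × P rest

PodPartition : ℕ → List ℕ → Set
PodPartition n l = IsPartition n l × LargestOnceRest OddDistinct l

PedPartition : ℕ → List ℕ → Set
PedPartition n l = IsPartition n l × LargestOnceRest EvenDistinct l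

record HasCard (P : List ℕ → Set) (c : ℕ) : Set where
  field
    elems    : List (List ℕ)
    unique   : Unique elems
    complete : ∀ l → (l ∈ elems) ⇔ P l
    size     : length elems ≡ c

FPS : Set
FPS = ℕ → ℤ

sumℤ : List ℤ → ℤ
sumℤ = foldr ℤ._+_ (+ 0)

oneS : FPS
oneS zero    = + 1
oneS (suc _) = + 0

mono : ℕ → FPS
mono e n = if does (n ℕ.≟ e) then + 1 else + 0

_-S_ : FPS → FPS → FPS
(f -S g) n = f n ℤ.- g n

_*S_ : FPS → FPS → FPS
(f *S g) n = sumℤ (map (λ i → f i ℤ.* g (n ∸ i)) (upTo (suc n)))

-- Multiplicative inverse of a series f with f 0 = 1:
-- invRev f n = [c_n , c_{n-1} , … , c_0] where
-- c_0 = 1 and c_m = - Σ_{i=1}^{m} f i * c_{m-i}.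
invRev : FPS → ℕ → List ℤ
invRev f zero    = + 1 ∷ []
invRev f (suc n) =
  let r = invRev f n in
  (- sumℤ (zipWith ℤ._*_ (map (λ i → f (suc i)) (upTo (suc n))) r)) ∷ r

inv : FPS → FPS
inv f n with invRev f n
... | []    = + 0
... | c ∷ _ = c

pochFin : ℕ → ℕ → FPS
pochFin k m = foldr (λ j acc → (oneS -S mono (k ℕ.* suc j)) *S acc) oneS (upTo m)

-- (q^k ; q^k)_∞ = ∏_{j≥1} (1 - q^{k j}) for k ≥ 1.  Its coefficient of q^n
-- agrees with that of the finite product over 1 ≤ j ≤ n (factors with j > n
-- only affect coefficients of degree > n when k ≥ 1).
poch : ℕ → FPS
poch k n = pochFin k n n

geom2 : FPS
geom2 = inv (oneS -S mono 2)

podRHS : FPS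
podRHS = (poch 4 *S inv (poch 2 *S poch 8)) -S geom2

pedRHS : FPS
pedRHS = (poch 8 *S inv (poch 2)) -S geom2

{-# OPTIONS --safe #-}
-- Removing the largest part λ of a partition counted by ρ leaves a restricted partition of λ
-- (odd parts distinct for pod, even parts distinct for ped) other than λ itself.  Hence ρ vanishes
-- at odd n and ρ(2λ) = p(λ) − 1, where p counts restricted partitions; that is,
-- Σ ρ(n) qⁿ = P(q²) − 1/(1 − q²) with P = Σ p(n) qⁿ.  Let P_M count restricted partitions into
-- parts ≤ M.  A part j that must be distinct multiplies P_M by 1 + q^j and a free part by
-- 1/(1 − q^j), so P_M (q;q)_M is the product of 1 − q^(2j) over the distinct parts j ≤ M.
-- Grouping these factors by parity and letting M → ∞ coefficientwise gives
-- P(q) (q;q)_∞ (q⁴;q⁴)_∞ = (q²;q²)_∞ for pod and P(q) (q;q)_∞ = (q⁴;q⁴)_∞ for ped.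

module Submission where

open import Defs
open import Algebra.Bundles using (CommutativeMonoid)
import Algebra.Properties.CommutativeSemigroup as CommutativeSemigroupProperties
open import Data.Empty using (⊥-elim)
open import Data.Integer using (ℤ; +_; -_; _+_; _*_; _-_)
import Data.Integer.Properties as ℤ
open import Data.Integer.Tactic.RingSolver using (solve-∀)
open import Data.List using (List; []; _∷_; [_]; map; upTo; applyUpTo; foldr; zipWith; _++_; length)
open import Data.List.Properties
  using ( map-applyUpTo; upTo-∷ʳ; foldr-++; length-++; length-map; ++-identityʳ; ∷-injectiveʳ
        ; filter-accept; filter-reject)
open import Data.List.Membership.Propositional using (_∈_)
open import Data.List.Membership.Propositional.Properties using (∈-map⁺; ∈-map⁻; ∈-++⁺ˡ; ∈-++⁺ʳ; ∈-++⁻)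
open import Data.List.Relation.Unary.All as All using (All; []; _∷_)
open import Data.List.Relation.Unary.AllPairs using ([]; _∷_)
open import Data.List.Relation.Unary.Any using (here)
open import Data.List.Relation.Unary.Linked as Linked using (Linked; []; [-]; _∷_)
open import Data.List.Relation.Unary.Linked.Properties using (Linked⇒All)
open import Data.List.Relation.Unary.Unique.Propositional using (Unique)
import Data.List.Relation.Unary.Unique.Propositional.Properties as Unique
open import Data.Nat as ℕ using (ℕ; zero; suc; _≤_; _<_; _≥_; _∸_; z≤n; s≤s; _≤?_)
open import Data.Nat.Divisibility using (_∣_; _∣?_; divides)
open import Data.Nat.ListAction using (sum)
open import Data.Nat.Properties
  using ( ≤-refl; ≤-trans; ≤-reflexive; ≤-pred; ≤∧≢⇒<; <⇒≢; ≰⇒>; n≮n; n≮0; n≤0⇒n≡0; 1+n≢0; n≤1+n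
        ; m≤n⇒m≤1+n; m∸n+n≡m; m+n∸m≡n; ∸-monoˡ-≤; m+[n∸m]≡n; m∸n≤m; n∸n≡0; m≤n+m; m≤m+n; m≤n*m
        ; +-suc; +-identityʳ; *-distribʳ-+; *-assoc; *-comm; suc-injective)
open import Data.Product using (Σ; ∃; _×_; _,_)
open import Data.Sum using (inj₁; inj₂)
open import Function using (_∘_)
open import Function.Bundles using (mk⇔)
open import Relation.Binary.Bundles using (Setoid)
open import Relation.Binary.PropositionalEquality hiding ([_])
import Relation.Binary.Reasoning.Setoid as SetoidReasoning
open import Relation.Nullary using (¬_; Dec; yes; no; ¬?)
open import Relation.Unary using (Decidable)

tail : FPS → FPS
tail f n = f (suc n)

infixl 6 _+S_
_+S_ : FPS → FPS → FPS
(f +S g) n = f n + g n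

_·S_ : ℤ → FPS → FPS
(a ·S f) n = a * f n

shift : ℕ → FPS → FPS
shift zero    g n       = g n
shift (suc e) g zero    = + 0
shift (suc e) g (suc n) = shift e g n

-- The Cauchy product _*S_ by recursion on the degree (see *S≗⊛), which suits induction.
infixl 7 _⊛_
_⊛_ : FPS → FPS → FPS
(f ⊛ g) zero    = f 0 * g 0
(f ⊛ g) (suc n) = f 0 * g (suc n) + (tail f ⊛ g) n

map-applyUpTo-suc : ∀ {A : Set} (h : ℕ → A) n → map h (applyUpTo suc n) ≡ map (h ∘ suc) (upTo n)
map-applyUpTo-suc h n = trans (map-applyUpTo suc h n) (sym (map-applyUpTo (λ i → i) (h ∘ suc) n))

*S≗⊛ : ∀ f g → f *S g ≗ f ⊛ g
*S≗⊛ f g zero    = ℤ.+-identityʳ _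
*S≗⊛ f g (suc n) = cong (_+_ (f 0 * g (suc n)))
  (trans (cong sumℤ (map-applyUpTo-suc (λ i → f i * g (suc n ∸ i)) (suc n))) (*S≗⊛ (tail f) g n))

infix 4 _≗[≤_]_
_≗[≤_]_ : FPS → ℕ → FPS → Set
f ≗[≤ n ] g = ∀ i → i ≤ n → f i ≡ g i

≗[≤]-weaken : ∀ {m n f g} → m ≤ n → f ≗[≤ n ] g → f ≗[≤ m ] g
≗[≤]-weaken m≤n f≗g i i≤m = f≗g i (≤-trans i≤m m≤n)

⊛-coeff-agree : ∀ n {f f′ g g′} → f ≗[≤ n ] f′ → g ≗[≤ n ] g′ → (f ⊛ g) n ≡ (f′ ⊛ g′) n
⊛-coeff-agree zero    f≗ g≗ = cong₂ _*_ (f≗ 0 z≤n) (g≗ 0 z≤n)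
⊛-coeff-agree (suc n) f≗ g≗ = cong₂ _+_ (cong₂ _*_ (f≗ 0 z≤n) (g≗ (suc n) ≤-refl))
  (⊛-coeff-agree n (λ i i≤n → f≗ (suc i) (s≤s i≤n)) (λ i i≤n → g≗ i (m≤n⇒m≤1+n i≤n)))

⊛-agree : ∀ {n f f′ g g′} → f ≗[≤ n ] f′ → g ≗[≤ n ] g′ → f ⊛ g ≗[≤ n ] f′ ⊛ g′
⊛-agree f≗ g≗ i i≤n = ⊛-coeff-agree i (≗[≤]-weaken i≤n f≗) (≗[≤]-weaken i≤n g≗)

⊛-cong : ∀ {f f′ g g′} → f ≗ f′ → g ≗ g′ → f ⊛ g ≗ f′ ⊛ g′
⊛-cong f≗ g≗ n = ⊛-coeff-agree n (λ i _ → f≗ i) (λ i _ → g≗ i)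

⊛-unfoldʳ : ∀ f g n → (f ⊛ g) (suc n) ≡ (f ⊛ tail g) n + f (suc n) * g 0
⊛-unfoldʳ f g zero    = refl
⊛-unfoldʳ f g (suc n) = trans (cong (_+_ (f 0 * g (suc (suc n)))) (⊛-unfoldʳ (tail f) g n))
                          (sym (ℤ.+-assoc (f 0 * g (suc (suc n))) ((tail f ⊛ tail g) n) (f (suc (suc n)) * g 0)))

⊛-comm : ∀ f g → f ⊛ g ≗ g ⊛ f
⊛-comm f g zero    = ℤ.*-comm (f 0) (g 0)
⊛-comm f g (suc n) = begin
  f 0 * g (suc n) + (tail f ⊛ g) n  ≡⟨ cong (_+_ (f 0 * g (suc n))) (⊛-comm (tail f) g n) ⟩
  f 0 * g (suc n) + (g ⊛ tail f) n  ≡⟨ ℤ.+-comm (f 0 * g (suc n)) ((g ⊛ tail f) n) ⟩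
  (g ⊛ tail f) n + f 0 * g (suc n)  ≡⟨ cong (_+_ ((g ⊛ tail f) n)) (ℤ.*-comm (f 0) (g (suc n))) ⟩
  (g ⊛ tail f) n + g (suc n) * f 0  ≡⟨ sym (⊛-unfoldʳ g f n) ⟩
  (g ⊛ f) (suc n)                   ∎
  where open ≡-Reasoning

⊛-distribʳ-+S : ∀ f g h → (f +S g) ⊛ h ≗ f ⊛ h +S g ⊛ h
⊛-distribʳ-+S f g h zero    = ℤ.*-distribʳ-+ (h 0) (f 0) (g 0)
⊛-distribʳ-+S f g h (suc n) =
  trans (cong (_+_ ((f 0 + g 0) * h (suc n))) (⊛-distribʳ-+S (tail f) (tail g) h n))
        (interchange (f 0) (g 0) (h (suc n)) ((tail f ⊛ h) n) ((tail g ⊛ h) n))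
  where
  interchange : ∀ a b c d e → (a + b) * c + (d + e) ≡ (a * c + d) + (b * c + e)
  interchange = solve-∀

⊛-distribʳ--S : ∀ f g h → (f -S g) ⊛ h ≗ (f ⊛ h) -S (g ⊛ h)
⊛-distribʳ--S f g h zero    = distrib (f 0) (g 0) (h 0)
  where
  distrib : ∀ a b c → (a - b) * c ≡ a * c - b * c
  distrib = solve-∀
⊛-distribʳ--S f g h (suc n) =
  trans (cong (_+_ ((f 0 - g 0) * h (suc n))) (⊛-distribʳ--S (tail f) (tail g) h n))
        (interchange (f 0) (g 0) (h (suc n)) ((tail f ⊛ h) n) ((tail g ⊛ h) n))
  where
  interchange : ∀ a b c d e → (a - b) * c + (d - e) ≡ (a * c + d) - (b * c + e)
  interchange = solve-∀

⊛-scaleˡ : ∀ a f g → (a ·S f) ⊛ g ≗ a ·S (f ⊛ g)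
⊛-scaleˡ a f g zero    = ℤ.*-assoc a (f 0) (g 0)
⊛-scaleˡ a f g (suc n) =
  trans (cong (_+_ ((a * f 0) * g (suc n))) (⊛-scaleˡ a (tail f) g n))
        (factor a (f 0) (g (suc n)) ((tail f ⊛ g) n))
  where
  factor : ∀ a b c d → (a * b) * c + a * d ≡ a * (b * c + d)
  factor = solve-∀

⊛-assoc : ∀ f g h → (f ⊛ g) ⊛ h ≗ f ⊛ (g ⊛ h)
⊛-assoc f g h zero    = ℤ.*-assoc (f 0) (g 0) (h 0)
⊛-assoc f g h (suc n) = begin
  (f 0 * g 0) * h (suc n) + ((f 0 ·S tail g +S tail f ⊛ g) ⊛ h) n
    ≡⟨ cong (_+_ ((f 0 * g 0) * h (suc n))) (⊛-distribʳ-+S (f 0 ·S tail g) (tail f ⊛ g) h n) ⟩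
  (f 0 * g 0) * h (suc n) + (((f 0 ·S tail g) ⊛ h) n + ((tail f ⊛ g) ⊛ h) n)
    ≡⟨ cong₂ (λ x y → (f 0 * g 0) * h (suc n) + (x + y))
             (⊛-scaleˡ (f 0) (tail g) h n) (⊛-assoc (tail f) g h n) ⟩
  (f 0 * g 0) * h (suc n) + (f 0 * (tail g ⊛ h) n + (tail f ⊛ (g ⊛ h)) n)
    ≡⟨ regroup (f 0) (g 0) (h (suc n)) ((tail g ⊛ h) n) ((tail f ⊛ (g ⊛ h)) n) ⟩
  f 0 * (g 0 * h (suc n) + (tail g ⊛ h) n) + (tail f ⊛ (g ⊛ h)) n
    ∎
  where
  open ≡-Reasoning
  regroup : ∀ a b c d e → (a * b) * c + (a * d + e) ≡ a * (b * c + d) + e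
  regroup = solve-∀

⊛-zeroˡ : ∀ g → (λ _ → + 0) ⊛ g ≗ (λ _ → + 0)
⊛-zeroˡ g zero    = refl
⊛-zeroˡ g (suc n) = cong (_+_ (+ 0 * g (suc n))) (⊛-zeroˡ g n)

⊛-identityˡ : ∀ g → oneS ⊛ g ≗ g
⊛-identityˡ g zero    = ℤ.*-identityˡ (g 0)
⊛-identityˡ g (suc n) = trans (cong (_+_ (+ 1 * g (suc n))) (⊛-zeroˡ g n))
                              (trans (ℤ.+-identityʳ _) (ℤ.*-identityˡ _))

⊛-identityʳ : ∀ g → g ⊛ oneS ≗ g
⊛-identityʳ g n = trans (⊛-comm g oneS n) (⊛-identityˡ g n)

≗-setoid : Setoid _ _
≗-setoid = record { Carrier = FPS ; _≈_ = _≗_ ; isEquivalence = record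
  { refl = λ _ → refl ; sym = λ p n → sym (p n) ; trans = λ p q n → trans (p n) (q n) } }

⊛-commutativeMonoid : CommutativeMonoid _ _
⊛-commutativeMonoid = record
  { Carrier = FPS ; _≈_ = _≗_ ; _∙_ = _⊛_ ; ε = oneS
  ; isCommutativeMonoid = record
    { isMonoid = record
      { isSemigroup = record
        { isMagma = record { isEquivalence = Setoid.isEquivalence ≗-setoid ; ∙-cong = ⊛-cong }
        ; assoc = ⊛-assoc }
      ; identity = ⊛-identityˡ , ⊛-identityʳ }
    ; comm = ⊛-comm } }

open CommutativeSemigroupProperties (CommutativeMonoid.commutativeSemigroup ⊛-commutativeMonoid)
  using (interchange; x∙yz≈y∙xz; xy∙z≈y∙xz)

⊛-mono : ∀ e g → mono e ⊛ g ≗ shift e g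
⊛-mono zero    g n = trans (⊛-cong mono-zero (λ _ → refl) n) (⊛-identityˡ g n)
  where
  mono-zero : mono 0 ≗ oneS
  mono-zero zero    = refl
  mono-zero (suc _) = refl
⊛-mono (suc e) g zero    = refl
⊛-mono (suc e) g (suc n) = trans (ℤ.+-identityˡ _) (⊛-mono e g n)

shift-oneS : ∀ e → shift e oneS ≗ mono e
shift-oneS zero    zero    = refl
shift-oneS zero    (suc n) = refl
shift-oneS (suc e) zero    = refl
shift-oneS (suc e) (suc n) = shift-oneS e n

shift-mono : ∀ e d → shift e (mono d) ≗ mono (e ℕ.+ d)
shift-mono zero    d n       = refl
shift-mono (suc e) d zero    = refl
shift-mono (suc e) d (suc n) = shift-mono e d n

shift--S : ∀ e f g → shift e (f -S g) ≗ shift e f -S shift e g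
shift--S zero    f g n       = refl
shift--S (suc e) f g zero    = refl
shift--S (suc e) f g (suc n) = shift--S e f g n

shift-low : ∀ e g {n} → n < e → shift e g n ≡ + 0
shift-low (suc e) g {zero}  _         = refl
shift-low (suc e) g {suc n} (s≤s n<e) = shift-low e g n<e

shift-high : ∀ e g {n} → e ≤ n → shift e g n ≡ g (n ∸ e)
shift-high zero    g _         = refl
shift-high (suc e) g (s≤s e≤n) = shift-high e g e≤n

1-q^_ : ℕ → FPS
1-q^ e = oneS -S mono e

1+q^_ : ℕ → FPS
1+q^ e = oneS +S mono e

1-q^-⊛ : ∀ e g → (1-q^ e) ⊛ g ≗ g -S shift e g
1-q^-⊛ e g n = trans (⊛-distribʳ--S oneS (mono e) g n) (cong₂ _-_ (⊛-identityˡ g n) (⊛-mono e g n))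

1+q^-⊛ : ∀ e g → (1+q^ e) ⊛ g ≗ g +S shift e g
1+q^-⊛ e g n = trans (⊛-distribʳ-+S oneS (mono e) g n) (cong₂ _+_ (⊛-identityˡ g n) (⊛-mono e g n))

1+q^-⊛-1-q^ : ∀ e → (1+q^ e) ⊛ (1-q^ e) ≗ 1-q^ (e ℕ.+ e)
1+q^-⊛-1-q^ e n = begin
  ((1+q^ e) ⊛ (1-q^ e)) n
    ≡⟨ 1+q^-⊛ e (1-q^ e) n ⟩
  (oneS n - mono e n) + shift e (1-q^ e) n
    ≡⟨ cong (_+_ (oneS n - mono e n)) (shift--S e oneS (mono e) n) ⟩
  (oneS n - mono e n) + (shift e oneS n - shift e (mono e) n)
    ≡⟨ cong₂ (λ x y → (oneS n - mono e n) + (x - y)) (shift-oneS e n) (shift-mono e e n) ⟩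
  (oneS n - mono e n) + (mono e n - mono (e ℕ.+ e) n)
    ≡⟨ telescope (oneS n) (mono e n) (mono (e ℕ.+ e) n) ⟩
  (1-q^ (e ℕ.+ e)) n
    ∎
  where
  open ≡-Reasoning
  telescope : ∀ a b c → (a - b) + (b - c) ≡ a - c
  telescope = solve-∀

zipWith-map-map : ∀ {A B C D : Set} (g : B → C → D) (a : A → B) (b : A → C) xs →
                  zipWith g (map a xs) (map b xs) ≡ map (λ i → g (a i) (b i)) xs
zipWith-map-map g a b []       = refl
zipWith-map-map g a b (x ∷ xs) = cong (g (a x) (b x) ∷_) (zipWith-map-map g a b xs)

invRev-coeffs : ∀ f n → invRev f n ≡ map (λ i → inv f (n ∸ i)) (upTo (suc n))
invRev-coeffs f zero    = refl
invRev-coeffs f (suc n) = cong (inv f (suc n) ∷_)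
  (trans (invRev-coeffs f n) (sym (map-applyUpTo-suc (λ i → inv f (suc n ∸ i)) (suc n))))

inv-suc : ∀ f n → inv f (suc n) ≡ - (tail f ⊛ inv f) n
inv-suc f n = cong -_ (begin
  sumℤ (zipWith _*_ (map (tail f) (upTo (suc n))) (invRev f n))
    ≡⟨ cong (sumℤ ∘ zipWith _*_ (map (tail f) (upTo (suc n)))) (invRev-coeffs f n) ⟩
  sumℤ (zipWith _*_ (map (tail f) (upTo (suc n))) (map (λ i → inv f (n ∸ i)) (upTo (suc n))))
    ≡⟨ cong sumℤ (zipWith-map-map _*_ (tail f) (λ i → inv f (n ∸ i)) (upTo (suc n))) ⟩
  (tail f *S inv f) n
    ≡⟨ *S≗⊛ (tail f) (inv f) n ⟩
  (tail f ⊛ inv f) n ∎)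
  where open ≡-Reasoning

⊛-inverseʳ : ∀ f → f 0 ≡ + 1 → f ⊛ inv f ≗ oneS
⊛-inverseʳ f f0≡1 zero    = cong (_* + 1) f0≡1
⊛-inverseʳ f f0≡1 (suc n) = begin
  f 0 * inv f (suc n) + (tail f ⊛ inv f) n
    ≡⟨ cong₂ (λ x y → x * y + (tail f ⊛ inv f) n) f0≡1 (inv-suc f n) ⟩
  + 1 * - (tail f ⊛ inv f) n + (tail f ⊛ inv f) n
    ≡⟨ cancel ((tail f ⊛ inv f) n) ⟩
  + 0 ∎
  where
  open ≡-Reasoning
  cancel : ∀ a → + 1 * - a + a ≡ + 0
  cancel = solve-∀

⊛-inv-cancelʳ : ∀ {f g h} → h 0 ≡ + 1 → f ⊛ h ≗ g → g ⊛ inv h ≗ f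
⊛-inv-cancelʳ {f} {g} {h} h0≡1 f⊛h≗g = begin
  g ⊛ inv h          ≈⟨ ⊛-cong (λ n → sym (f⊛h≗g n)) (λ _ → refl) ⟩
  (f ⊛ h) ⊛ inv h    ≈⟨ ⊛-assoc f h (inv h) ⟩
  f ⊛ (h ⊛ inv h)    ≈⟨ ⊛-cong (λ _ → refl) (⊛-inverseʳ h h0≡1) ⟩
  f ⊛ oneS           ≈⟨ ⊛-identityʳ f ⟩
  f                  ∎
  where open SetoidReasoning ≗-setoid

double : ℕ → ℕ
double zero    = zero
double (suc n) = suc (suc (double n))

data Parity : ℕ → Set where
  even : ∀ s → Parity (double s)
  odd  : ∀ s → Parity (suc (double s))

parity : ∀ n → Parity n
parity zero = even zero
parity (suc n) with parity n
... | even s = odd s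
... | odd s  = even (suc s)

double≡+ : ∀ n → double n ≡ n ℕ.+ n
double≡+ zero    = refl
double≡+ (suc n) = cong suc (trans (cong suc (double≡+ n)) (sym (+-suc n n)))

double≡2* : ∀ n → double n ≡ 2 ℕ.* n
double≡2* n = trans (double≡+ n) (cong (n ℕ.+_) (sym (+-identityʳ n)))

double-injective : ∀ {m n} → double m ≡ double n → m ≡ n
double-injective {zero}  {zero}  _  = refl
double-injective {suc m} {suc n} eq = cong suc (double-injective (suc-injective (suc-injective eq)))

double≢odd : ∀ m n → double m ≢ suc (double n)
double≢odd (suc m) (suc n) eq = double≢odd m n (suc-injective (suc-injective eq))

n≤double : ∀ n → n ≤ double n
n≤double n = subst (n ≤_) (sym (double≡+ n)) (m≤m+n n n)

double-+-double : ∀ n → double n ℕ.+ double n ≡ 4 ℕ.* n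
double-+-double n = trans (cong₂ ℕ._+_ (double≡2* n) (double≡2* n)) (sym (*-distribʳ-+ n 2 2))

8*≡4*double : ∀ n → 8 ℕ.* n ≡ 4 ℕ.* double n
8*≡4*double n = trans (*-assoc 4 2 n) (cong (4 ℕ.*_) (sym (double≡2* n)))

foldr-*S-pull : ∀ (F : ℕ → FPS) xs {X Y Z} → Z ≗ X ⊛ Y →
                foldr (λ j acc → F j *S acc) Z xs ≗ X ⊛ foldr (λ j acc → F j *S acc) Y xs
foldr-*S-pull F []       Z≗X⊛Y = Z≗X⊛Y
foldr-*S-pull F (j ∷ xs) {X} {Y} {Z} Z≗X⊛Y = begin
  F j *S ∏ Z                 ≈⟨ *S≗⊛ (F j) (∏ Z) ⟩
  F j ⊛ ∏ Z                  ≈⟨ ⊛-cong (λ _ → refl) (foldr-*S-pull F xs Z≗X⊛Y) ⟩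
  F j ⊛ (X ⊛ ∏ Y)            ≈⟨ x∙yz≈y∙xz (F j) X (∏ Y) ⟩
  X ⊛ (F j ⊛ ∏ Y)            ≈⟨ ⊛-cong (λ _ → refl) (λ n → sym (*S≗⊛ (F j) (∏ Y) n)) ⟩
  X ⊛ (F j *S ∏ Y)           ∎
  where
  open SetoidReasoning ≗-setoid
  ∏ : FPS → FPS
  ∏ acc = foldr (λ j acc → F j *S acc) acc xs

pochFin-suc : ∀ k m → pochFin k (suc m) ≗ (1-q^ (k ℕ.* suc m)) ⊛ pochFin k m
pochFin-suc k m n = begin
  foldr step oneS (upTo (suc m)) n        ≡⟨ cong (λ xs → foldr step oneS xs n) (sym (upTo-∷ʳ m)) ⟩
  foldr step oneS (upTo m ++ [ m ]) n     ≡⟨ cong-app (foldr-++ step oneS (upTo m) [ m ]) n ⟩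
  foldr step (step m oneS) (upTo m) n     ≡⟨ foldr-*S-pull F (upTo m) (*S≗⊛ (F m) oneS) n ⟩
  (F m ⊛ pochFin k m) n                   ∎
  where
  open ≡-Reasoning
  F : ℕ → FPS
  F j = 1-q^ (k ℕ.* suc j)
  step : ℕ → FPS → FPS
  step j acc = F j *S acc

pochFin2-suc : ∀ m → pochFin 2 (suc m) ≗ (1-q^ (double (suc m))) ⊛ pochFin 2 m
pochFin2-suc m n =
  trans (pochFin-suc 2 m n) (⊛-cong (cong-app (cong 1-q^_ (sym (double≡2* (suc m))))) (λ _ → refl) n)

pochFin-suc-low : ∀ k m {t} → t < k ℕ.* suc m → pochFin k (suc m) t ≡ pochFin k m t
pochFin-suc-low k m {t} t<e = begin
  pochFin k (suc m) t                                  ≡⟨ pochFin-suc k m t ⟩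
  ((1-q^ (k ℕ.* suc m)) ⊛ pochFin k m) t               ≡⟨ 1-q^-⊛ (k ℕ.* suc m) (pochFin k m) t ⟩
  pochFin k m t - shift (k ℕ.* suc m) (pochFin k m) t  ≡⟨ cong (_-_ (pochFin k m t)) (shift-low _ _ t<e) ⟩
  pochFin k m t - + 0                                  ≡⟨ ℤ.+-identityʳ (pochFin k m t) ⟩
  pochFin k m t                                        ∎
  where open ≡-Reasoning

-- Only the factors with k j ≤ t affect the coefficient of q^t.
pochFin-stable : ∀ k d t → pochFin (suc k) (d ℕ.+ t) t ≡ poch (suc k) t
pochFin-stable k zero    t = refl
pochFin-stable k (suc d) t =
  trans (pochFin-suc-low (suc k) (d ℕ.+ t) (≤-trans (s≤s (m≤n+m t d)) (m≤n*m (suc (d ℕ.+ t)) (suc k))))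
        (pochFin-stable k d t)

pochFin-agree : ∀ k M → pochFin (suc k) M ≗[≤ M ] poch (suc k)
pochFin-agree k M t t≤M =
  trans (cong (λ m → pochFin (suc k) m t) (sym (m∸n+n≡m t≤M))) (pochFin-stable k (M ∸ t) t)

-- The counts live at even exponents: dilate a = Σ a s q^(2s).
dilate : FPS → FPS
dilate a zero          = a 0
dilate a (suc zero)    = + 0
dilate a (suc (suc n)) = dilate (tail a) n

dilate-double : ∀ a s → dilate a (double s) ≡ a s
dilate-double a zero    = refl
dilate-double a (suc s) = dilate-double (tail a) s

dilate-odd : ∀ a s → dilate a (suc (double s)) ≡ + 0
dilate-odd a zero    = refl
dilate-odd a (suc s) = dilate-odd (tail a) s

dilate-cong : ∀ {a b} → a ≗ b → dilate a ≗ dilate b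
dilate-cong a≗b zero          = a≗b 0
dilate-cong a≗b (suc zero)    = refl
dilate-cong a≗b (suc (suc n)) = dilate-cong (a≗b ∘ suc) n

dilate-+S : ∀ a b → dilate (a +S b) ≗ dilate a +S dilate b
dilate-+S a b zero          = refl
dilate-+S a b (suc zero)    = refl
dilate-+S a b (suc (suc n)) = dilate-+S (tail a) (tail b) n

dilate-shift : ∀ e a → dilate (shift e a) ≗ shift (double e) (dilate a)
dilate-shift zero    a n             = refl
dilate-shift (suc e) a zero          = refl
dilate-shift (suc e) a (suc zero)    = refl
dilate-shift (suc e) a (suc (suc n)) = dilate-shift e a n

dilate-oneS : dilate oneS ≗ oneS
dilate-oneS zero          = refl
dilate-oneS (suc zero)    = refl
dilate-oneS (suc (suc n)) = dilate-zero n
  where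
  dilate-zero : ∀ n → dilate (λ _ → + 0) n ≡ + 0
  dilate-zero zero          = refl
  dilate-zero (suc zero)    = refl
  dilate-zero (suc (suc n)) = dilate-zero n

geom2≗dilate-one : geom2 ≗ dilate (λ _ → + 1)
geom2≗dilate-one zero          = refl
geom2≗dilate-one (suc zero)    = refl
geom2≗dilate-one (suc (suc n)) = trans (ℤ.i-j≡0⇒i≡j _ _ recurrence) (geom2≗dilate-one n)
  where
  recurrence : geom2 (suc (suc n)) - geom2 n ≡ + 0
  recurrence = trans (sym (1-q^-⊛ 2 geom2 (suc (suc n)))) (⊛-inverseʳ (1-q^ 2) refl (suc (suc n)))

mult-here : ∀ k r → mult k (k ∷ r) ≡ suc (mult k r)
mult-here k r = cong length (filter-accept (ℕ._≟ k) refl)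

mult-there : ∀ {k x} r → x ≢ k → mult k (x ∷ r) ≡ mult k r
mult-there {k} r x≢k = cong length (filter-reject (ℕ._≟ k) x≢k)

mult-∷-≤ : ∀ k x r → mult k r ≤ mult k (x ∷ r)
mult-∷-≤ k x r with x ℕ.≟ k
... | yes refl = subst (mult k r ≤_) (sym (mult-here k r)) (n≤1+n _)
... | no x≢k  = ≤-reflexive (sym (mult-there r x≢k))

mult-absent : ∀ {k r} → All (_< k) r → mult k r ≡ 0
mult-absent []                    = refl
mult-absent {r = _ ∷ r} (x<k ∷ r<k) = trans (mult-there r (<⇒≢ x<k)) (mult-absent r<k)

mult≡0⇒< : ∀ {k r} → All (_≤ k) r → mult k r ≡ 0 → All (_< k) r
mult≡0⇒< [] _ = []
mult≡0⇒< {k} {x ∷ r} (x≤k ∷ r≤k) m≡0 with x ℕ.≟ k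
... | yes refl = ⊥-elim (1+n≢0 (trans (sym (mult-here k r)) m≡0))
... | no x≢k  = ≤∧≢⇒< x≤k x≢k ∷ mult≡0⇒< r≤k (trans (sym (mult-there r x≢k)) m≡0)

linked⇒all≤ : ∀ {x r} → Linked _≥_ (x ∷ r) → All (_≤ x) r
linked⇒all≤ [-]       = []
linked⇒all≤ (y≤x ∷ l) = Linked⇒All (λ a b → ≤-trans b a) y≤x l

all≤⇒linked : ∀ {x r} → All (_≤ x) r → Linked _≥_ r → Linked _≥_ (x ∷ r)
all≤⇒linked []        []  = [-]
all≤⇒linked (y≤x ∷ _) l   = y≤x ∷ l

IsPartition-∷ : ∀ {x s r} → 1 ≤ x → All (_≤ x) r → IsPartition s r → IsPartition (x ℕ.+ s) (x ∷ r)
IsPartition-∷ {x} 1≤x r≤x (pos , lk , sum≡s) = 1≤x ∷ pos , all≤⇒linked r≤x lk , cong (x ℕ.+_) sum≡s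

IsPartition-tail : ∀ {x s r} → IsPartition s (x ∷ r) → IsPartition (s ∸ x) r
IsPartition-tail {x} {r = r} (_ ∷ pos , lk , sum≡s) =
  pos , Linked.tail lk , trans (sym (m+n∸m≡n x (sum r))) (cong (_∸ x) sum≡s)

IsPartition-head≤ : ∀ {x s r} → IsPartition s (x ∷ r) → x ≤ s
IsPartition-head≤ {x} {r = r} (_ , _ , sum≡s) = subst (x ≤_) sum≡s (m≤m+n x (sum r))

∸-suc-≤ : ∀ {s f m} → s ≤ suc f → s ∸ suc m ≤ f
∸-suc-≤ {f = f} {m} s≤ = ≤-trans (∸-monoˡ-≤ (suc m) s≤) (m∸n≤m f m)

HasCard-empty : ∀ {P} → (∀ l → ¬ P l) → HasCard P 0
HasCard-empty ¬P = record
  { elems = [] ; unique = [] ; complete = λ l → mk⇔ (λ ()) (⊥-elim ∘ ¬P l) ; size = refl }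

module RestrictedPartitions (Distinct : ℕ → Set) (distinct? : Decidable Distinct) where

  Restricted : List ℕ → Set
  Restricted l = ∀ k → Distinct k → mult k l ≤ 1

  Restricted-tail : ∀ {x r} → Restricted (x ∷ r) → Restricted r
  Restricted-tail {x} {r} R k pk = ≤-trans (mult-∷-≤ k x r) (R k pk)

  Restricted-∷ : ∀ {x r} → Restricted r → (Distinct x → All (_< x) r) → Restricted (x ∷ r)
  Restricted-∷ {x} {r} R r<x k pk with x ℕ.≟ k
  ... | yes refl = ≤-reflexive (trans (mult-here x r) (cong suc (mult-absent (r<x pk))))
  ... | no x≢k  = subst (_≤ 1) (sym (mult-there r x≢k)) (R k pk)

  Restricted-head : ∀ {x r} → Restricted (x ∷ r) → Distinct x → All (_≤ x) r → All (_< x) r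
  Restricted-head {x} {r} R px r≤x =
    mult≡0⇒< r≤x (n≤0⇒n≡0 (≤-pred (subst (_≤ 1) (mult-here x r) (R x px))))

  BoundedPartition : ℕ → ℕ → List ℕ → Set
  BoundedPartition M s l = IsPartition s l × All (_≤ M) l × Restricted l

  BoundedPartition-weaken : ∀ {M N s l} → M ≤ N → BoundedPartition M s l → BoundedPartition N s l
  BoundedPartition-weaken M≤N (p , l≤M , R) = p , All.map (λ x≤M → ≤-trans x≤M M≤N) l≤M , R

  BoundedPartition-∷ : ∀ {M s r} → suc M ≤ s → BoundedPartition (suc M) (s ∸ suc M) r →
                       (Distinct (suc M) → All (_< suc M) r) → BoundedPartition (suc M) s (suc M ∷ r)
  BoundedPartition-∷ le (p , r≤ , R) r< =
    subst (λ t → IsPartition t _) (m+[n∸m]≡n le) (IsPartition-∷ (s≤s z≤n) r≤ p) ,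
    ≤-refl ∷ r≤ ,
    Restricted-∷ R r<

  BoundedPartition-tail : ∀ {M s x r} → BoundedPartition M s (x ∷ r) → BoundedPartition M (s ∸ x) r
  BoundedPartition-tail {x = x} {r} (p , _ ∷ r≤ , R) = IsPartition-tail p , r≤ , Restricted-tail {x} {r} R

  BoundedPartition-tail-allowed : ∀ {M s r} → BoundedPartition (suc M) s (suc M ∷ r) → Distinct (suc M) →
                                  BoundedPartition M (s ∸ suc M) r
  BoundedPartition-tail-allowed b@((_ , lk , _) , _ , R) pd with BoundedPartition-tail b
  ... | p , _ , R′ = p , All.map ≤-pred (Restricted-head R pd (linked⇒all≤ lk)) , R′

  BoundedPartition-lower : ∀ {M s x r} → BoundedPartition (suc M) s (x ∷ r) → x ≢ suc M →
                           BoundedPartition M s (x ∷ r)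
  BoundedPartition-lower {M} {x = x} (p@(_ , lk , _) , x≤ ∷ _ , R) x≢ =
    p , x≤M ∷ All.map (λ y≤x → ≤-trans y≤x x≤M) (linked⇒all≤ lk) , R
    where
    x≤M : x ≤ M
    x≤M = ≤-pred (≤∧≢⇒< x≤ x≢)

  -- The fuel (at least s) only serves termination: a largest part that may repeat is removed
  -- without lowering the bound M.
  mutual
    partitions : (fuel M s : ℕ) → List (List ℕ)
    partitions fuel zero    zero    = [ [] ]
    partitions fuel zero    (suc s) = []
    partitions fuel (suc M) s       = partitions fuel M s ++ withLargest fuel M s (suc M ≤? s) (distinct? (suc M))

    withLargest : (fuel M s : ℕ) → Dec (suc M ≤ s) → Dec (Distinct (suc M)) → List (List ℕ)
    withLargest fuel       M s (no _)  _       = []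
    withLargest fuel       M s (yes _) (yes _) = map (suc M ∷_) (partitions fuel M (s ∸ suc M))
    withLargest zero       M s (yes _) (no _)  = []
    withLargest (suc fuel) M s (yes _) (no _)  = map (suc M ∷_) (partitions fuel (suc M) (s ∸ suc M))

  mutual
    partitions-sound : ∀ fuel M s {l} → l ∈ partitions fuel M s → BoundedPartition M s l
    partitions-sound fuel zero    zero (here refl) = ([] , [] , refl) , [] , λ _ _ → z≤n
    partitions-sound fuel (suc M) s l∈ with ∈-++⁻ (partitions fuel M s) l∈
    ... | inj₁ l∈′ = BoundedPartition-weaken (n≤1+n M) (partitions-sound fuel M s l∈′)
    ... | inj₂ l∈′ = withLargest-sound fuel M s (suc M ≤? s) (distinct? (suc M)) l∈′

    withLargest-sound : ∀ fuel M s d e {l} → l ∈ withLargest fuel M s d e → BoundedPartition (suc M) s l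
    withLargest-sound fuel M s (yes le) (yes _) l∈ with ∈-map⁻ (suc M ∷_) l∈
    ... | r , r∈ , refl with partitions-sound fuel M (s ∸ suc M) r∈
    ...   | b@(_ , r≤M , _) = BoundedPartition-∷ le (BoundedPartition-weaken (n≤1+n M) b) (λ _ → All.map s≤s r≤M)
    withLargest-sound (suc fuel) M s (yes le) (no ¬pd) l∈ with ∈-map⁻ (suc M ∷_) l∈
    ... | r , r∈ , refl = BoundedPartition-∷ le (partitions-sound fuel (suc M) (s ∸ suc M) r∈) (⊥-elim ∘ ¬pd)

  mutual
    partitions-complete : ∀ fuel M s {l} → s ≤ fuel → BoundedPartition M s l → l ∈ partitions fuel M s
    partitions-complete fuel zero    zero    {[]}    _ _                             = here refl
    partitions-complete fuel zero    (suc s) {[]}    _ ((_ , _ , ()) , _)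
    partitions-complete fuel zero    s       {x ∷ r} _ ((s≤s _ ∷ _ , _) , () ∷ _ , _)
    partitions-complete fuel (suc M) s       {[]}    s≤ (p , [] , R) =
      ∈-++⁺ˡ (partitions-complete fuel M s s≤ (p , [] , R))
    partitions-complete fuel (suc M) s       {x ∷ r} s≤ b with x ℕ.≟ suc M
    ... | no x≢   = ∈-++⁺ˡ (partitions-complete fuel M s s≤ (BoundedPartition-lower b x≢))
    ... | yes refl =
      ∈-++⁺ʳ (partitions fuel M s) (withLargest-complete fuel M s (suc M ≤? s) (distinct? (suc M)) s≤ b)

    withLargest-complete : ∀ fuel M s {r} d e → s ≤ fuel → BoundedPartition (suc M) s (suc M ∷ r) →
                           (suc M ∷ r) ∈ withLargest fuel M s d e
    withLargest-complete fuel M s (no ≰) _ _ (p , _) = ⊥-elim (≰ (IsPartition-head≤ p))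
    withLargest-complete fuel M s (yes _) (yes pd) s≤ b =
      ∈-map⁺ (suc M ∷_) (partitions-complete fuel M (s ∸ suc M) (≤-trans (m∸n≤m s (suc M)) s≤)
                                              (BoundedPartition-tail-allowed b pd))
    withLargest-complete zero M s (yes le) (no _) s≤0 _ = ⊥-elim (n≮0 (≤-trans le s≤0))
    withLargest-complete (suc fuel) M s (yes _) (no _) s≤ b =
      ∈-map⁺ (suc M ∷_) (partitions-complete fuel (suc M) (s ∸ suc M) (∸-suc-≤ s≤) (BoundedPartition-tail b))

  withLargest-head : ∀ fuel M s d e {l} → l ∈ withLargest fuel M s d e → ∃ λ r → l ≡ suc M ∷ r
  withLargest-head fuel M s (yes _) (yes _) l∈ with ∈-map⁻ (suc M ∷_) l∈
  ... | r , _ , l≡ = r , l≡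
  withLargest-head (suc fuel) M s (yes _) (no _) l∈ with ∈-map⁻ (suc M ∷_) l∈
  ... | r , _ , l≡ = r , l≡

  mutual
    partitions-unique : ∀ fuel M s → Unique (partitions fuel M s)
    partitions-unique fuel zero    zero    = [] ∷ []
    partitions-unique fuel zero    (suc s) = []
    partitions-unique fuel (suc M) s       =
      Unique.++⁺ (partitions-unique fuel M s)
                 (withLargest-unique fuel M s (suc M ≤? s) (distinct? (suc M)))
                 disjoint
      where
      disjoint : ∀ {l} → ¬ (l ∈ partitions fuel M s × l ∈ withLargest fuel M s (suc M ≤? s) (distinct? (suc M)))
      disjoint (l∈ , l∈′) with withLargest-head fuel M s (suc M ≤? s) (distinct? (suc M)) l∈′
      ... | r , refl with partitions-sound fuel M s l∈
      ...   | _ , sM≤M ∷ _ , _ = n≮n M sM≤M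

    withLargest-unique : ∀ fuel M s d e → Unique (withLargest fuel M s d e)
    withLargest-unique fuel       M s (no _)  _       = []
    withLargest-unique fuel       M s (yes _) (yes _) =
      Unique.map⁺ ∷-injectiveʳ (partitions-unique fuel M (s ∸ suc M))
    withLargest-unique zero       M s (yes _) (no _)  = []
    withLargest-unique (suc fuel) M s (yes _) (no _)  =
      Unique.map⁺ ∷-injectiveʳ (partitions-unique fuel (suc M) (s ∸ suc M))

  mutual
    partitions-fuel : ∀ {f g} M s → s ≤ f → s ≤ g → partitions f M s ≡ partitions g M s
    partitions-fuel zero    zero    _   _   = refl
    partitions-fuel zero    (suc s) _   _   = refl
    partitions-fuel (suc M) s       s≤f s≤g =
      cong₂ _++_ (partitions-fuel M s s≤f s≤g) (withLargest-fuel M s (suc M ≤? s) (distinct? (suc M)) s≤f s≤g)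

    withLargest-fuel : ∀ {f g} M s d e → s ≤ f → s ≤ g → withLargest f M s d e ≡ withLargest g M s d e
    withLargest-fuel M s (no _) _ _ _ = refl
    withLargest-fuel M s (yes _) (yes _) s≤f s≤g = cong (map (suc M ∷_))
      (partitions-fuel M (s ∸ suc M) (≤-trans (m∸n≤m s (suc M)) s≤f) (≤-trans (m∸n≤m s (suc M)) s≤g))
    withLargest-fuel {zero}  M s (yes le) (no _) s≤0 _ = ⊥-elim (n≮0 (≤-trans le s≤0))
    withLargest-fuel {suc _} {zero} M s (yes le) (no _) _ s≤0 = ⊥-elim (n≮0 (≤-trans le s≤0))
    withLargest-fuel {suc _} {suc _} M s (yes _) (no _) s≤f s≤g =
      cong (map (suc M ∷_)) (partitions-fuel (suc M) (s ∸ suc M) (∸-suc-≤ s≤f) (∸-suc-≤ s≤g))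

  partitions-zero : ∀ fuel M → partitions fuel M 0 ≡ [ [] ]
  partitions-zero fuel zero    = refl
  partitions-zero fuel (suc M) = trans (++-identityʳ (partitions fuel M 0)) (partitions-zero fuel M)

  boundedCount : ℕ → ℕ → ℕ
  boundedCount M s = length (partitions s M s)

  restrictedCount : ℕ → ℕ
  restrictedCount s = boundedCount s s

  boundedSeries : ℕ → FPS
  boundedSeries M = dilate (λ s → + boundedCount M s)

  restrictedSeries : FPS
  restrictedSeries = dilate (λ s → + restrictedCount s)

  boundedSeries-zero : boundedSeries 0 ≗ oneS
  boundedSeries-zero n = trans (dilate-cong count≗oneS n) (dilate-oneS n)
    where
    count≗oneS : (λ s → + boundedCount 0 s) ≗ oneS
    count≗oneS zero    = refl
    count≗oneS (suc _) = refl

  -- X is the bound on the remaining parts once one largest part suc M is removed.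
  boundedSeries-suc : ∀ M X →
    (∀ {s} (le : suc M ≤ s) e → length (withLargest s M s (yes le) e) ≡ boundedCount X (s ∸ suc M)) →
    boundedSeries (suc M) ≗ boundedSeries M +S shift (double (suc M)) (boundedSeries X)
  boundedSeries-suc M X largest n = begin
    dilate (count (suc M)) n
      ≡⟨ dilate-cong count-suc n ⟩
    dilate (count M +S shift (suc M) (count X)) n
      ≡⟨ dilate-+S (count M) (shift (suc M) (count X)) n ⟩
    boundedSeries M n + dilate (shift (suc M) (count X)) n
      ≡⟨ cong (_+_ (boundedSeries M n)) (dilate-shift (suc M) (count X) n) ⟩
    boundedSeries M n + shift (double (suc M)) (boundedSeries X) n
      ∎
    where
    open ≡-Reasoning
    count : ℕ → FPS
    count M s = + boundedCount M s

    withLargest-count : ∀ {s} d → + length (withLargest s M s d (distinct? (suc M))) ≡ shift (suc M) (count X) s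
    withLargest-count (no ≰)   = sym (shift-low (suc M) (count X) (≰⇒> ≰))
    withLargest-count (yes le) =
      trans (cong +_ (largest le (distinct? (suc M)))) (sym (shift-high (suc M) (count X) le))

    count-suc : count (suc M) ≗ count M +S shift (suc M) (count X)
    count-suc s = trans (cong +_ (length-++ (partitions s M s)))
                        (trans (ℤ.pos-+ (boundedCount M s) _)
                               (cong (_+_ (count M s)) (withLargest-count (suc M ≤? s))))

  boundedSeries-allowed : ∀ M → Distinct (suc M) →
                          boundedSeries (suc M) ≗ (1+q^ (double (suc M))) ⊛ boundedSeries M
  boundedSeries-allowed M pd n =
    trans (boundedSeries-suc M M largest n) (sym (1+q^-⊛ (double (suc M)) (boundedSeries M) n))
    where
    largest : ∀ {s} (le : suc M ≤ s) e → length (withLargest s M s (yes le) e) ≡ boundedCount M (s ∸ suc M)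
    largest le     (no ¬pd) = ⊥-elim (¬pd pd)
    largest {s} le (yes _)  = trans (length-map (suc M ∷_) (partitions s M (s ∸ suc M)))
                                    (cong length (partitions-fuel M (s ∸ suc M) (m∸n≤m s (suc M)) ≤-refl))

  boundedSeries-free : ∀ M → ¬ Distinct (suc M) →
                       (1-q^ (double (suc M))) ⊛ boundedSeries (suc M) ≗ boundedSeries M
  boundedSeries-free M ¬pd n = begin
    ((1-q^ e) ⊛ boundedSeries (suc M)) n       ≡⟨ 1-q^-⊛ e (boundedSeries (suc M)) n ⟩
    boundedSeries (suc M) n - q^e·bS n         ≡⟨ cong (_- q^e·bS n) (boundedSeries-suc M (suc M) largest n) ⟩
    boundedSeries M n + q^e·bS n - q^e·bS n    ≡⟨ cancel (boundedSeries M n) (q^e·bS n) ⟩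
    boundedSeries M n                          ∎
    where
    open ≡-Reasoning
    e : ℕ
    e = double (suc M)
    q^e·bS : FPS
    q^e·bS = shift e (boundedSeries (suc M))
    cancel : ∀ a b → a + b - b ≡ a
    cancel = solve-∀
    largest : ∀ {s} (le : suc M ≤ s) e → length (withLargest s M s (yes le) e) ≡ boundedCount (suc M) (s ∸ suc M)
    largest         le (yes pd) = ⊥-elim (¬pd pd)
    largest {suc s} le (no _)   = trans (length-map (suc M ∷_) (partitions s (suc M) (s ∸ M)))
                                        (cong length (partitions-fuel (suc M) (s ∸ M) (m∸n≤m s M) ≤-refl))

  boundedCount-suc-low : ∀ {M s} → s ≤ M → boundedCount (suc M) s ≡ boundedCount M s
  boundedCount-suc-low {M} {s} s≤M =
    trans (length-++ (partitions s M s)) (trans (cong (boundedCount M s ℕ.+_) (none (suc M ≤? s))) (+-identityʳ _))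
    where
    none : ∀ d → length (withLargest s M s d (distinct? (suc M))) ≡ 0
    none (no _)     = refl
    none (yes sM≤s) = ⊥-elim (n≮n M (≤-trans sM≤s s≤M))

  boundedCount-stable : ∀ d s → boundedCount (d ℕ.+ s) s ≡ restrictedCount s
  boundedCount-stable zero    s = refl
  boundedCount-stable (suc d) s = trans (boundedCount-suc-low (m≤n+m s d)) (boundedCount-stable d s)

  boundedSeries-agree : ∀ M → boundedSeries M ≗[≤ M ] restrictedSeries
  boundedSeries-agree M t t≤M with parity t
  ... | odd s  = trans (dilate-odd _ s) (sym (dilate-odd _ s))
  ... | even s = trans (dilate-double _ s) (trans (cong +_ count≡) (sym (dilate-double _ s)))
    where
    s≤M : s ≤ M
    s≤M = ≤-trans (n≤double s) t≤M
    count≡ : boundedCount M s ≡ restrictedCount s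
    count≡ = trans (cong (λ m → boundedCount m s) (sym (m∸n+n≡m s≤M))) (boundedCount-stable (M ∸ s) s)

  restrictedCount-suc : ∀ p → restrictedCount (suc p) ≡ boundedCount p (suc p) ℕ.+ 1
  restrictedCount-suc p = trans (length-++ (partitions (suc p) p (suc p)))
                                (cong (boundedCount p (suc p) ℕ.+_) (single (suc p ≤? suc p) (distinct? (suc p))))
    where
    single : ∀ d e → length (withLargest (suc p) p (suc p) d e) ≡ 1
    single (no ≰)  _       = ⊥-elim (≰ ≤-refl)
    single (yes _) (yes _) = trans (length-map (suc p ∷_) (partitions (suc p) p (p ∸ p)))
      (cong length (trans (cong (partitions (suc p) p) (n∸n≡0 p)) (partitions-zero (suc p) p)))
    single (yes _) (no _)  = trans (length-map (suc p ∷_) (partitions p (suc p) (p ∸ p)))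
      (cong length (trans (cong (partitions p (suc p)) (n∸n≡0 p)) (partitions-zero p (suc p))))

  -- A part j that may occur at most once contributes (1 + q^(2j)) (1 - q^(2j)) = 1 - q^(4j).
  restrictedPoch : ℕ → FPS
  restrictedPoch zero = oneS
  restrictedPoch (suc M) with distinct? (suc M)
  ... | yes _ = (1-q^ (4 ℕ.* suc M)) ⊛ restrictedPoch M
  ... | no _  = restrictedPoch M

  restrictedPoch-allowed : ∀ M → Distinct (suc M) →
                           restrictedPoch (suc M) ≡ (1-q^ (4 ℕ.* suc M)) ⊛ restrictedPoch M
  restrictedPoch-allowed M pd with distinct? (suc M)
  ... | yes _  = refl
  ... | no ¬pd = ⊥-elim (¬pd pd)

  restrictedPoch-free : ∀ M → ¬ Distinct (suc M) → restrictedPoch (suc M) ≡ restrictedPoch M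
  restrictedPoch-free M ¬pd with distinct? (suc M)
  ... | yes pd = ⊥-elim (¬pd pd)
  ... | no _   = refl

  boundedSeries-⊛-pochFin : ∀ M → boundedSeries M ⊛ pochFin 2 M ≗ restrictedPoch M
  boundedSeries-⊛-pochFin zero = begin
    boundedSeries 0 ⊛ oneS  ≈⟨ ⊛-identityʳ (boundedSeries 0) ⟩
    boundedSeries 0         ≈⟨ boundedSeries-zero ⟩
    oneS                    ∎
    where open SetoidReasoning ≗-setoid
  boundedSeries-⊛-pochFin (suc M) = step (distinct? (suc M))
    where
    open SetoidReasoning ≗-setoid
    e : ℕ
    e = double (suc M)
    step : Dec (Distinct (suc M)) → boundedSeries (suc M) ⊛ pochFin 2 (suc M) ≗ restrictedPoch (suc M)
    step (yes pd) = begin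
      boundedSeries (suc M) ⊛ pochFin 2 (suc M)
        ≈⟨ ⊛-cong (boundedSeries-allowed M pd) (pochFin2-suc M) ⟩
      ((1+q^ e) ⊛ boundedSeries M) ⊛ ((1-q^ e) ⊛ pochFin 2 M)
        ≈⟨ interchange (1+q^ e) (boundedSeries M) (1-q^ e) (pochFin 2 M) ⟩
      ((1+q^ e) ⊛ (1-q^ e)) ⊛ (boundedSeries M ⊛ pochFin 2 M)
        ≈⟨ ⊛-cong (1+q^-⊛-1-q^ e) (boundedSeries-⊛-pochFin M) ⟩
      (1-q^ (e ℕ.+ e)) ⊛ restrictedPoch M
        ≡⟨ cong (λ d → (1-q^ d) ⊛ restrictedPoch M) (double-+-double (suc M)) ⟩
      (1-q^ (4 ℕ.* suc M)) ⊛ restrictedPoch M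
        ≡⟨ restrictedPoch-allowed M pd ⟨
      restrictedPoch (suc M)
        ∎
    step (no ¬pd) = begin
      boundedSeries (suc M) ⊛ pochFin 2 (suc M)
        ≈⟨ ⊛-cong (λ _ → refl) (pochFin2-suc M) ⟩
      boundedSeries (suc M) ⊛ ((1-q^ e) ⊛ pochFin 2 M)
        ≈⟨ x∙yz≈y∙xz (boundedSeries (suc M)) (1-q^ e) (pochFin 2 M) ⟩
      (1-q^ e) ⊛ (boundedSeries (suc M) ⊛ pochFin 2 M)
        ≈⟨ ⊛-assoc (1-q^ e) (boundedSeries (suc M)) (pochFin 2 M) ⟨
      ((1-q^ e) ⊛ boundedSeries (suc M)) ⊛ pochFin 2 M
        ≈⟨ ⊛-cong (boundedSeries-free M ¬pd) (λ _ → refl) ⟩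
      boundedSeries M ⊛ pochFin 2 M
        ≈⟨ boundedSeries-⊛-pochFin M ⟩
      restrictedPoch M
        ≡⟨ restrictedPoch-free M ¬pd ⟨
      restrictedPoch (suc M)
        ∎

  LargestOncePartition : ℕ → List ℕ → Set
  LargestOncePartition n l = IsPartition n l × LargestOnceRest Restricted l

  largestOnce-double : ∀ {n x r} → LargestOncePartition n (x ∷ r) → n ≡ double x
  largestOnce-double {x = x} ((_ , _ , sum≡n) , _ , sum≡x , _) =
    trans (sym sum≡n) (trans (cong (x ℕ.+_) sum≡x) (sym (double≡+ x)))

  no-largestOnce-zero : ∀ l → ¬ LargestOncePartition 0 l
  no-largestOnce-zero (_ ∷ _) lop@((s≤s _ ∷ _ , _) , _) with largestOnce-double lop
  ... | ()

  no-largestOnce-odd : ∀ s l → ¬ LargestOncePartition (suc (double s)) l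
  no-largestOnce-odd s (x ∷ _) lop = double≢odd x s (sym (largestOnce-double lop))

  largestOnce-card : ∀ p → HasCard (LargestOncePartition (double (suc p))) (boundedCount p (suc p))
  largestOnce-card p = record
    { elems    = elems
    ; unique   = Unique.map⁺ ∷-injectiveʳ (partitions-unique (suc p) p (suc p))
    ; complete = λ l → mk⇔ sound (complete l)
    ; size     = length-map (suc p ∷_) (partitions (suc p) p (suc p))
    }
    where
    elems : List (List ℕ)
    elems = map (suc p ∷_) (partitions (suc p) p (suc p))

    sound : ∀ {l} → l ∈ elems → LargestOncePartition (double (suc p)) l
    sound l∈ with ∈-map⁻ (suc p ∷_) l∈
    ... | r , r∈ , refl with partitions-sound (suc p) p (suc p) r∈
    ...   | q@(_ , _ , sum≡) , r≤p , R =
      subst (λ n → IsPartition n (suc p ∷ r)) (sym (double≡+ (suc p)))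
            (IsPartition-∷ (s≤s z≤n) (All.map m≤n⇒m≤1+n r≤p) q) ,
      All.map s≤s r≤p , sum≡ , R

    complete : ∀ l → LargestOncePartition (double (suc p)) l → l ∈ elems
    complete (x ∷ r) lop@((_ ∷ pos , lk , _) , r<x , sum≡x , R)
      with double-injective (sym (largestOnce-double lop))
    ... | refl = ∈-map⁺ (suc p ∷_) (partitions-complete (suc p) p (suc p) ≤-refl
                                      ((pos , Linked.tail lk , sum≡x) , All.map ≤-pred r<x , R))

  restrictedSeries-geom2-odd : ∀ s → (restrictedSeries -S geom2) (suc (double s)) ≡ + 0
  restrictedSeries-geom2-odd s = cong₂ _-_ (dilate-odd (λ s → + restrictedCount s) s)
                                           (trans (geom2≗dilate-one (suc (double s))) (dilate-odd (λ _ → + 1) s))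

  restrictedSeries-geom2-even : ∀ p → (restrictedSeries -S geom2) (double (suc p)) ≡ + boundedCount p (suc p)
  restrictedSeries-geom2-even p = begin
    restrictedSeries (double (suc p)) - geom2 (double (suc p))
      ≡⟨ cong₂ _-_ (dilate-double (λ s → + restrictedCount s) (suc p))
                   (trans (geom2≗dilate-one (double (suc p))) (dilate-double (λ _ → + 1) (suc p))) ⟩
    + restrictedCount (suc p) - + 1                   ≡⟨ cong (λ c → + c - + 1) (restrictedCount-suc p) ⟩
    + (boundedCount p (suc p) ℕ.+ 1) - + 1            ≡⟨ cong (_- + 1) (ℤ.pos-+ (boundedCount p (suc p)) 1) ⟩
    + boundedCount p (suc p) + + 1 - + 1              ≡⟨ cancel (+ boundedCount p (suc p)) (+ 1) ⟩
    + boundedCount p (suc p)                          ∎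
    where
    open ≡-Reasoning
    cancel : ∀ a b → a + b - b ≡ a
    cancel = solve-∀

  largestOnce-count : (R : FPS) → R ≗ restrictedSeries -S geom2 →
                      ∀ n → Σ ℕ λ c → HasCard (LargestOncePartition n) c × + c ≡ R n
  largestOnce-count R R≗ n with parity n
  ... | even zero    = 0 , HasCard-empty no-largestOnce-zero , sym (R≗ 0)
  ... | odd s        =
    0 , HasCard-empty (no-largestOnce-odd s) , sym (trans (R≗ _) (restrictedSeries-geom2-odd s))
  ... | even (suc p) =
    boundedCount p (suc p) , largestOnce-card p , sym (trans (R≗ _) (restrictedSeries-geom2-even p))

2∣double : ∀ m → 2 ∣ double m
2∣double m = divides m (trans (double≡2* m) (*-comm 2 m))

2∤odd : ∀ m → ¬ 2 ∣ suc (double m)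
2∤odd m (divides q eq) = double≢odd q m (sym (trans eq (trans (*-comm q 2) (sym (double≡2* q)))))

module Pod = RestrictedPartitions (λ k → ¬ 2 ∣ k) (λ k → ¬? (2 ∣? k))
module Ped = RestrictedPartitions (2 ∣_) (2 ∣?_)

pod-restrictedPoch : ∀ m → Pod.restrictedPoch (double m) ⊛ pochFin 8 m ≗ pochFin 4 (double m)
pod-restrictedPoch zero    = ⊛-identityˡ oneS
pod-restrictedPoch (suc m) = begin
  Pod.restrictedPoch (suc (suc (double m))) ⊛ pochFin 8 (suc m)
    ≡⟨ cong (_⊛ pochFin 8 (suc m)) (trans (Pod.restrictedPoch-free (suc (double m)) (λ 2∤ → 2∤ (2∣double (suc m))))
                                          (Pod.restrictedPoch-allowed (double m) (2∤odd m))) ⟩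
  (a ⊛ Pod.restrictedPoch (double m)) ⊛ pochFin 8 (suc m)
    ≈⟨ ⊛-cong (λ _ → refl) (pochFin-suc 8 m) ⟩
  (a ⊛ Pod.restrictedPoch (double m)) ⊛ (b ⊛ pochFin 8 m)
    ≈⟨ interchange a (Pod.restrictedPoch (double m)) b (pochFin 8 m) ⟩
  (a ⊛ b) ⊛ (Pod.restrictedPoch (double m) ⊛ pochFin 8 m)
    ≈⟨ xy∙z≈y∙xz a b (Pod.restrictedPoch (double m) ⊛ pochFin 8 m) ⟩
  b ⊛ (a ⊛ (Pod.restrictedPoch (double m) ⊛ pochFin 8 m))
    ≈⟨ ⊛-cong (cong-app (cong 1-q^_ (8*≡4*double (suc m)))) (⊛-cong (λ _ → refl) (pod-restrictedPoch m)) ⟩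
  (1-q^ (4 ℕ.* double (suc m))) ⊛ (a ⊛ pochFin 4 (double m))
    ≈⟨ ⊛-cong (λ _ → refl) (pochFin-suc 4 (double m)) ⟨
  (1-q^ (4 ℕ.* double (suc m))) ⊛ pochFin 4 (suc (double m))
    ≈⟨ pochFin-suc 4 (suc (double m)) ⟨
  pochFin 4 (double (suc m))
    ∎
  where
  open SetoidReasoning ≗-setoid
  a b : FPS
  a = 1-q^ (4 ℕ.* suc (double m))
  b = 1-q^ (8 ℕ.* suc m)

ped-restrictedPoch : ∀ m → Ped.restrictedPoch (double m) ≗ pochFin 8 m
ped-restrictedPoch zero    _ = refl
ped-restrictedPoch (suc m) = begin
  Ped.restrictedPoch (suc (suc (double m)))
    ≡⟨ trans (Ped.restrictedPoch-allowed (suc (double m)) (2∣double (suc m)))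
             (cong ((1-q^ (4 ℕ.* double (suc m))) ⊛_) (Ped.restrictedPoch-free (double m) (2∤odd m))) ⟩
  (1-q^ (4 ℕ.* double (suc m))) ⊛ Ped.restrictedPoch (double m)
    ≈⟨ ⊛-cong (cong-app (cong 1-q^_ (sym (8*≡4*double (suc m))))) (ped-restrictedPoch m) ⟩
  (1-q^ (8 ℕ.* suc m)) ⊛ pochFin 8 m
    ≈⟨ pochFin-suc 8 m ⟨
  pochFin 8 (suc m)
    ∎
  where open SetoidReasoning ≗-setoid

pod-product : Pod.restrictedSeries ⊛ (poch 2 ⊛ poch 8) ≗ poch 4
pod-product n = begin
  (Pod.restrictedSeries ⊛ (poch 2 ⊛ poch 8)) n
    ≡⟨ ⊛-coeff-agree n (≗[≤]-weaken (n≤double n) (Pod.boundedSeries-agree (double n)))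
                       (⊛-agree (≗[≤]-weaken (n≤double n) (pochFin-agree 1 (double n))) (pochFin-agree 7 n)) ⟨
  (Pod.boundedSeries (double n) ⊛ (pochFin 2 (double n) ⊛ pochFin 8 n)) n
    ≡⟨ ⊛-assoc (Pod.boundedSeries (double n)) (pochFin 2 (double n)) (pochFin 8 n) n ⟨
  ((Pod.boundedSeries (double n) ⊛ pochFin 2 (double n)) ⊛ pochFin 8 n) n
    ≡⟨ ⊛-cong (Pod.boundedSeries-⊛-pochFin (double n)) (λ _ → refl) n ⟩
  (Pod.restrictedPoch (double n) ⊛ pochFin 8 n) n
    ≡⟨ pod-restrictedPoch n n ⟩
  pochFin 4 (double n) n
    ≡⟨ pochFin-agree 3 (double n) n (n≤double n) ⟩
  poch 4 n
    ∎
  where open ≡-Reasoning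

ped-product : Ped.restrictedSeries ⊛ poch 2 ≗ poch 8
ped-product n = begin
  (Ped.restrictedSeries ⊛ poch 2) n
    ≡⟨ ⊛-coeff-agree n (≗[≤]-weaken (n≤double n) (Ped.boundedSeries-agree (double n)))
                       (≗[≤]-weaken (n≤double n) (pochFin-agree 1 (double n))) ⟨
  (Ped.boundedSeries (double n) ⊛ pochFin 2 (double n)) n
    ≡⟨ Ped.boundedSeries-⊛-pochFin (double n) n ⟩
  Ped.restrictedPoch (double n) n
    ≡⟨ ped-restrictedPoch n n ⟩
  poch 8 n
    ∎
  where open ≡-Reasoning

pod-rhs : podRHS ≗ Pod.restrictedSeries -S geom2
pod-rhs n = cong (_- geom2 n) (trans (*S≗⊛ (poch 4) _ n) (⊛-inv-cancelʳ refl product n))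
  where
  product : Pod.restrictedSeries ⊛ (poch 2 *S poch 8) ≗ poch 4
  product k = trans (⊛-cong (λ _ → refl) (*S≗⊛ (poch 2) (poch 8)) k) (pod-product k)

ped-rhs : pedRHS ≗ Ped.restrictedSeries -S geom2
ped-rhs n = cong (_- geom2 n) (trans (*S≗⊛ (poch 8) _ n) (⊛-inv-cancelʳ refl ped-product n))

theorem1p6 : ((n : ℕ) → Σ ℕ (λ c → HasCard (PodPartition n) c × (+ c ≡ podRHS n)))
           × ((n : ℕ) → Σ ℕ (λ c → HasCard (PedPartition n) c × (+ c ≡ pedRHS n)))
theorem1p6 = Pod.largestOnce-count podRHS pod-rhs , Ped.largestOnce-count pedRHS ped-rhs
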